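{- Let $n\ge 1$. Among all trees on $n$ vertices, the star $S_n=K_{1,n-1}$ has the maximum number of total dominating sets.
   Context: A set $D\subseteq V(G)$ of a finite simple graph $G$ is a total dominating set if every vertex of $G$ is adjacent to some vertex of $D$. -}

module Defs where

open import Data.Nat using (ℕ; zero; suc; _+_; _≤_; _≥_)
open import Data.Bool using (Bool; true; false; _∧_; _∨_; not; if_then_else_; T)
open import Data.Fin using (Fin; zero; suc)
open import Data.Vec using (Vec; []; _∷_)
open import Data.List using (List; []; _∷_; _++_; map; length; filter)
open import Data.List.Relation.Unary.Unique.Propositional using (Unique)
open import Data.Product using (Σ; _×_; ∃; ∃-syntax)
open import Relation.Binary.PropositionalEquality using (_≡_)
open import Relation.Nullary using (¬_)
open import Data.Fin.Subset using (Subset) renaming (_∈_ to _∈ₛ_)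
open import Data.Fin.Properties using (any?; all?)
open import Relation.Nullary.Decidable using (Dec; _×-dec_)
open import Data.Bool.Properties using (T?)
open import Relation.Unary using (Decidable)
open import Relation.Nullary.Decidable using (does)
open import Data.Fin.Subset.Properties using (_∈?_)

record Graph (n : ℕ) : Set where
  field
    adj      : Fin n → Fin n → Bool
    symmetric   : ∀ u v → adj u v ≡ adj v u
    irreflexive : ∀ v → adj v v ≡ false
open Graph public

Adjacent : ∀ {n} → Graph n → Fin n → Fin n → Set
Adjacent G u v = T (adj G u v)

data Path {n} (G : Graph n) : Fin n → Fin n → Set where
  here : ∀ {v} → Path G v v
  step : ∀ {u w v} → Adjacent G u w → Path G w v → Path G u v

Connected : ∀ {n} → Graph n → Set
Connected G = ∀ u v → Path G u v

data Chain {n} (G : Graph n) : List (Fin n) → Set where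
  nil  : Chain G []
  one  : ∀ {v} → Chain G (v ∷ [])
  cons : ∀ {u w vs} → Adjacent G u w → Chain G (w ∷ vs) → Chain G (u ∷ w ∷ vs)

Cycle : ∀ {n} → Graph n → List (Fin n) → Set
Cycle G [] = Data.Empty.⊥ where import Data.Empty
Cycle G (v ∷ vs) =
  3 ≤ length (v ∷ vs) × Unique (v ∷ vs) × Chain G (v ∷ vs ++ v ∷ [])

Acyclic : ∀ {n} → Graph n → Set
Acyclic G = ∀ cs → ¬ Cycle G cs

IsTree : ∀ {n} → Graph n → Set
IsTree G = Connected G × Acyclic G

IsTotalDominating : ∀ {n} → Graph n → Subset n → Set
IsTotalDominating {n} G D = ∀ v → ∃[ u ] (u ∈ₛ D × Adjacent G v u)

isTotalDominating? : ∀ {n} (G : Graph n) (D : Subset n) → Dec (IsTotalDominating G D)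
isTotalDominating? G D = all? (λ v → any? (λ u → (u ∈? D) ×-dec T? (adj G v u)))

allSubsets : ∀ n → List (Subset n)
allSubsets zero = [] ∷ []
allSubsets (suc n) = map (true ∷_) (allSubsets n) ++ map (false ∷_) (allSubsets n)

countTrue : ∀ {A : Set} → (A → Bool) → List A → ℕ
countTrue p [] = 0
countTrue p (x ∷ xs) = (if p x then 1 else 0) + countTrue p xs

numTDS : ∀ {n} → Graph n → ℕ
numTDS {n} G = countTrue (λ D → does (isTotalDominating? G D)) (allSubsets n)

isZero : ∀ {n} → Fin n → Bool
isZero zero = true
isZero (suc _) = false

starAdj : ∀ {n} → Fin n → Fin n → Bool
starAdj u v = (isZero u ∧ not (isZero v)) ∨ (not (isZero u) ∧ isZero v)

star : ∀ n → Graph n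
star n = record { adj = starAdj ; symmetric = sym' ; irreflexive = irr }
  where
  open import Relation.Binary.PropositionalEquality using (refl)
  sym' : ∀ (u v : Fin n) → starAdj u v ≡ starAdj v u
  sym' zero zero = refl
  sym' zero (suc v) = refl
  sym' (suc u) zero = refl
  sym' (suc u) (suc v) = refl
  irr : ∀ (v : Fin n) → starAdj v v ≡ false
  irr zero = refl
  irr (suc v) = refl

-- An acyclic graph on at least one vertex has a vertex l with at most one
-- neighbour s (the end of a maximal path).  A total dominating set must
-- dominate l, so it contains s, and it must dominate s, so it contains a
-- second vertex.  There are 2^(n-1) - 1 such sets whatever s is, and for the
-- star with s its centre every one of them is total dominating.
module Submission where

open import Defs
open import Data.Bool using (Bool; true; false; _∧_; _∨_; T; if_then_else_)
open import Data.Bool.Properties using (∧-identityʳ; T-∧; T?)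
open import Function.Base using (_∘_)
open import Function.Bundles using (Equivalence)
open import Data.Empty using (⊥-elim)
open import Data.Fin using (Fin; zero; suc; _≟_) renaming (_<_ to _<ᶠ_)
open import Data.Fin.Properties using (pigeonhole; any?)
open import Data.Fin.Subset using (Subset; _∈_)
open import Data.List using (List; []; _∷_; _++_; map; length; lookup)
open import Data.List.Membership.Propositional using () renaming (_∈_ to _∈ˡ_)
open import Data.List.Membership.Propositional.Properties using (∈-∃++; ∈-lookup)
open import Data.List.Relation.Unary.All as All using (All; []; _∷_)
open import Data.List.Relation.Unary.All.Properties using (++⁻ˡ; ++⁻ʳ; ¬Any⇒All¬)
open import Data.List.Relation.Unary.AllPairs using ([]; _∷_)
open import Data.List.Relation.Unary.Any using (here; there)
open import Data.List.Relation.Unary.Unique.Propositional using (Unique)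
open import Data.Nat using (ℕ; zero; suc; _+_; _^_; _≤_; _≥_; _<_; z≤n; s≤s; _≤?_)
open import Data.Nat.Properties using (+-assoc; +-suc; +-identityʳ; m≤n⇒m≤1+n; ≰⇒>; suc-injective; ≤-trans; ≤-refl; ≤-reflexive; <⇒≱)
open import Data.Product using (_×_; _,_; ∃-syntax; ∃₂)
open import Data.Unit using (tt)
open import Data.Vec using ([]; _∷_; here; there; _[_]≔_) renaming (lookup to lookupᵛ)
open import Data.Vec.Properties using ([]=⇒lookup; []≔-minimal)
open import Relation.Binary.PropositionalEquality using (_≡_; _≢_; refl; sym; trans; cong; cong₂; subst; module ≡-Reasoning)
open import Relation.Nullary using (Dec; does; ¬_; yes; no; ¬?)
open import Relation.Nullary.Decidable using (_×-dec_; toWitness; fromWitness; isYes≗does; decidable-stable)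

open ≡-Reasoning

adjacent-sym : ∀ {n} (G : Graph n) {u v} → Adjacent G u v → Adjacent G v u
adjacent-sym G {u} {v} = subst T (symmetric G u v)

adjacent⇒≢ : ∀ {n} (G : Graph n) {u v} → Adjacent G u v → u ≢ v
adjacent⇒≢ G {u} a refl = subst T (irreflexive G u) a

T-does⇒witness : ∀ {A : Set} (a? : Dec A) → T (does a?) → A
T-does⇒witness a? = toWitness ∘ subst T (sym (isYes≗does a?))

witness⇒T-does : ∀ {A : Set} (a? : Dec A) → A → T (does a?)
witness⇒T-does a? = subst T (isYes≗does a?) ∘ fromWitness

countTrue-++ : ∀ {A : Set} (p : A → Bool) xs ys →
  countTrue p (xs ++ ys) ≡ countTrue p xs + countTrue p ys
countTrue-++ p []       ys = refl
countTrue-++ p (x ∷ xs) ys =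
  trans (cong (indicator +_) (countTrue-++ p xs ys)) (sym (+-assoc indicator (countTrue p xs) _))
  where
  indicator : ℕ
  indicator = if p x then 1 else 0

countTrue-map : ∀ {A B : Set} (p : B → Bool) (f : A → B) xs →
  countTrue p (map f xs) ≡ countTrue (λ x → p (f x)) xs
countTrue-map p f []       = refl
countTrue-map p f (x ∷ xs) = cong ((if p (f x) then 1 else 0) +_) (countTrue-map p f xs)

countTrue-cong : ∀ {A : Set} {p q : A → Bool} → (∀ x → p x ≡ q x) →
  ∀ xs → countTrue p xs ≡ countTrue q xs
countTrue-cong p≗q []       = refl
countTrue-cong p≗q (x ∷ xs) = cong₂ _+_ (cong (λ b → if b then 1 else 0) (p≗q x)) (countTrue-cong p≗q xs)

countTrue-mono : ∀ {A : Set} {p q : A → Bool} → (∀ x → T (p x) → T (q x)) →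
  ∀ xs → countTrue p xs ≤ countTrue q xs
countTrue-mono p⇒q [] = z≤n
countTrue-mono {p = p} {q} p⇒q (x ∷ xs) with p x | q x | p⇒q x
... | true  | true  | _   = s≤s (countTrue-mono p⇒q xs)
... | true  | false | p⇒q = ⊥-elim (p⇒q tt)
... | false | true  | _   = m≤n⇒m≤1+n (countTrue-mono p⇒q xs)
... | false | false | _   = countTrue-mono p⇒q xs

countTrue-false : ∀ {A : Set} (xs : List A) → countTrue (λ _ → false) xs ≡ 0
countTrue-false []       = refl
countTrue-false (x ∷ xs) = countTrue-false xs

countTrue-allSubsets-suc : ∀ n (p : Subset (suc n) → Bool) →
  countTrue p (allSubsets (suc n)) ≡
  countTrue (λ D → p (true ∷ D)) (allSubsets n) + countTrue (λ D → p (false ∷ D)) (allSubsets n)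
countTrue-allSubsets-suc n p =
  trans (countTrue-++ p (map (true ∷_) (allSubsets n)) (map (false ∷_) (allSubsets n)))
        (cong₂ _+_ (countTrue-map p (true ∷_) (allSubsets n)) (countTrue-map p (false ∷_) (allSubsets n)))

2^k+2^k≡2^suc-k : ∀ k → 2 ^ k + 2 ^ k ≡ 2 ^ suc k
2^k+2^k≡2^suc-k k = cong (2 ^ k +_) (sym (+-identityʳ (2 ^ k)))

suc-sum≡2^suc : ∀ k {a c} → a ≡ 2 ^ k → suc c ≡ 2 ^ k → suc (a + c) ≡ 2 ^ suc k
suc-sum≡2^suc k {c = c} refl sc≡2^k = begin
  suc (2 ^ k + c)         ≡⟨ sym (+-suc (2 ^ k) c) ⟩
  2 ^ k + suc c           ≡⟨ cong (2 ^ k +_) sc≡2^k ⟩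
  2 ^ k + 2 ^ k           ≡⟨ 2^k+2^k≡2^suc-k k ⟩
  2 ^ suc k               ∎

countTrue-true : ∀ n → countTrue (λ _ → true) (allSubsets n) ≡ 2 ^ n
countTrue-true zero    = refl
countTrue-true (suc n) = begin
  countTrue (λ _ → true) (allSubsets (suc n))    ≡⟨ countTrue-allSubsets-suc n (λ _ → true) ⟩
  c + c                                         ≡⟨ cong₂ _+_ (countTrue-true n) (countTrue-true n) ⟩
  2 ^ n + 2 ^ n                                 ≡⟨ 2^k+2^k≡2^suc-k n ⟩
  2 ^ suc n                                     ∎
  where
  c : ℕ
  c = countTrue (λ _ → true) (allSubsets n)

countTrue-lookup : ∀ m (s : Fin (suc m)) → countTrue (λ D → lookupᵛ D s) (allSubsets (suc m)) ≡ 2 ^ m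
countTrue-lookup m zero = begin
  countTrue (λ D → lookupᵛ D zero) (allSubsets (suc m))    ≡⟨ countTrue-allSubsets-suc m (λ D → lookupᵛ D zero) ⟩
  countTrue (λ _ → true) (allSubsets m) + countTrue (λ _ → false) (allSubsets m)
    ≡⟨ cong₂ _+_ (countTrue-true m) (countTrue-false (allSubsets m)) ⟩
  2 ^ m + 0                                                ≡⟨ +-identityʳ (2 ^ m) ⟩
  2 ^ m                                                    ∎
countTrue-lookup (suc m) (suc s) = begin
  countTrue (λ D → lookupᵛ D (suc s)) (allSubsets (suc (suc m)))
    ≡⟨ countTrue-allSubsets-suc (suc m) (λ D → lookupᵛ D (suc s)) ⟩
  c + c                    ≡⟨ cong₂ _+_ (countTrue-lookup m s) (countTrue-lookup m s) ⟩
  2 ^ m + 2 ^ m            ≡⟨ 2^k+2^k≡2^suc-k m ⟩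
  2 ^ suc m                ∎
  where
  c : ℕ
  c = countTrue (λ D → lookupᵛ D s) (allSubsets (suc m))

nonemptyᵇ : ∀ {n} → Subset n → Bool
nonemptyᵇ []      = false
nonemptyᵇ (b ∷ D) = b ∨ nonemptyᵇ D

nonemptyᵇ-intro : ∀ {n} {D : Subset n} {u} → u ∈ D → T (nonemptyᵇ D)
nonemptyᵇ-intro here = tt
nonemptyᵇ-intro {D = true ∷ D} (there u∈D) = tt
nonemptyᵇ-intro {D = false ∷ D} (there u∈D) = nonemptyᵇ-intro u∈D

nonemptyᵇ-elim : ∀ {n} (D : Subset n) → T (nonemptyᵇ D) → ∃[ u ] u ∈ D
nonemptyᵇ-elim (true ∷ D)  _ = zero , here
nonemptyᵇ-elim (false ∷ D) t with nonemptyᵇ-elim D t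
... | u , u∈D = suc u , there u∈D

countTrue-nonemptyᵇ : ∀ n → suc (countTrue nonemptyᵇ (allSubsets n)) ≡ 2 ^ n
countTrue-nonemptyᵇ zero    = refl
countTrue-nonemptyᵇ (suc n) =
  trans (cong suc (countTrue-allSubsets-suc n nonemptyᵇ))
        (suc-sum≡2^suc n (countTrue-true n) (countTrue-nonemptyᵇ n))

∋-and-otherᵇ : ∀ {n} → Fin n → Subset n → Bool
∋-and-otherᵇ s D = lookupᵛ D s ∧ nonemptyᵇ (D [ s ]≔ false)

countTrue-∋-and-otherᵇ : ∀ m (s : Fin (suc m)) →
  suc (countTrue (∋-and-otherᵇ s) (allSubsets (suc m))) ≡ 2 ^ m
countTrue-∋-and-otherᵇ m zero = begin
  suc (countTrue (∋-and-otherᵇ zero) (allSubsets (suc m)))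
    ≡⟨ cong suc (countTrue-allSubsets-suc m (∋-and-otherᵇ zero)) ⟩
  suc (countTrue nonemptyᵇ (allSubsets m) + countTrue (λ _ → false) (allSubsets m))
    ≡⟨ cong (λ k → suc (countTrue nonemptyᵇ (allSubsets m) + k)) (countTrue-false (allSubsets m)) ⟩
  suc (countTrue nonemptyᵇ (allSubsets m) + 0)
    ≡⟨ cong suc (+-identityʳ _) ⟩
  suc (countTrue nonemptyᵇ (allSubsets m))
    ≡⟨ countTrue-nonemptyᵇ m ⟩
  2 ^ m ∎
countTrue-∋-and-otherᵇ (suc m) (suc s) = begin
  suc (countTrue (∋-and-otherᵇ (suc s)) (allSubsets (suc (suc m))))
    ≡⟨ cong suc (countTrue-allSubsets-suc (suc m) (∋-and-otherᵇ (suc s))) ⟩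
  suc (countTrue (λ D → lookupᵛ D s ∧ true) (allSubsets (suc m)) + c)
    ≡⟨ suc-sum≡2^suc m (trans (countTrue-cong (λ D → ∧-identityʳ (lookupᵛ D s)) (allSubsets (suc m)))
                           (countTrue-lookup m s))
                    (countTrue-∋-and-otherᵇ m s) ⟩
  2 ^ suc m ∎
  where
  c : ℕ
  c = countTrue (∋-and-otherᵇ s) (allSubsets (suc m))

countTrue-∋-and-otherᵇ-independent : ∀ m (s : Fin (suc m)) →
  countTrue (∋-and-otherᵇ s) (allSubsets (suc m)) ≡ countTrue (∋-and-otherᵇ zero) (allSubsets (suc m))
countTrue-∋-and-otherᵇ-independent m s =
  suc-injective (trans (countTrue-∋-and-otherᵇ m s) (sym (countTrue-∋-and-otherᵇ m zero)))

star-connected : ∀ {n} → Connected (star n)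
star-connected zero    zero    = here
star-connected zero    (suc v) = step tt here
star-connected (suc u) zero    = step tt here
star-connected (suc u) (suc v) = step tt (step tt here)

-- Every edge of the star has the centre as an end point.
star-between-distinct-is-centre : ∀ {n} {a b c : Fin (suc n)} →
  Adjacent (star (suc n)) a b → Adjacent (star (suc n)) b c → a ≢ c → b ≡ zero
star-between-distinct-is-centre {b = zero} _ _ _ = refl
star-between-distinct-is-centre {a = zero}  {b = suc _} {c = zero}  _  _  a≢c = ⊥-elim (a≢c refl)
star-between-distinct-is-centre {a = zero}  {b = suc _} {c = suc _} _  () _
star-between-distinct-is-centre {a = suc _} {b = suc _}             () _  _

star-acyclic : ∀ {n} → Acyclic (star n)
star-acyclic [] ()
star-acyclic (a ∷ []) (s≤s () , _)
star-acyclic (a ∷ b ∷ []) (s≤s (s≤s ()) , _)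
star-acyclic {suc _} (a ∷ b ∷ c ∷ []) (_ , (a≢b ∷ a≢c ∷ []) ∷ _ , cons ab (cons bc (cons ca one))) =
  adjacent⇒≢ (star _) bc
    (trans (star-between-distinct-is-centre ab bc a≢c)
           (sym (star-between-distinct-is-centre bc ca (λ b≡a → a≢b (sym b≡a)))))
star-acyclic {suc _} (a ∷ b ∷ c ∷ d ∷ _) (_ , (_ ∷ a≢c ∷ _) ∷ (_ ∷ b≢d ∷ _) ∷ _ , cons ab (cons bc (cons cd _))) =
  adjacent⇒≢ (star _) bc
    (trans (star-between-distinct-is-centre ab bc a≢c) (sym (star-between-distinct-is-centre bc cd b≢d)))

∋-and-otherᵇ⇒star-totalDominating : ∀ {m} (D : Subset (suc m)) →
  T (∋-and-otherᵇ zero D) → IsTotalDominating (star (suc m)) D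
∋-and-otherᵇ⇒star-totalDominating (true ∷ D) other zero with nonemptyᵇ-elim D other
... | u , u∈D = suc u , there u∈D , tt
∋-and-otherᵇ⇒star-totalDominating (true ∷ D) _ (suc v) = zero , here , tt

Unique⇒lookup-injective : ∀ {A : Set} (xs : List A) → Unique xs →
  ∀ i j → i <ᶠ j → lookup xs i ≢ lookup xs j
Unique⇒lookup-injective (x ∷ xs) (x∉xs ∷ _)  zero    (suc j) _         = All.lookup x∉xs (∈-lookup j)
Unique⇒lookup-injective (x ∷ xs) (_ ∷ uxs) (suc i) (suc j) (s≤s i<j) = Unique⇒lookup-injective xs uxs i j i<j

Unique⇒length≤ : ∀ {n} (xs : List (Fin n)) → Unique xs → length xs ≤ n
Unique⇒length≤ {n} xs uxs with length xs ≤? n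
... | yes ≤n = ≤n
... | no  ≰n with pigeonhole (≰⇒> ≰n) (lookup xs)
... | i , j , i<j , eq = ⊥-elim (Unique⇒lookup-injective xs uxs i j i<j eq)

Unique-++-∷⇒Unique-∷ : ∀ {A : Set} {u : A} {ys} xs → Unique (xs ++ u ∷ ys) → Unique (u ∷ xs)
Unique-++-∷⇒Unique-∷ []       _               = [] ∷ []
Unique-++-∷⇒Unique-∷ (x ∷ xs) (x∉ ∷ uniq) with Unique-++-∷⇒Unique-∷ xs uniq
... | u∉xs ∷ uxs with ++⁻ʳ xs x∉
...   | x≢u ∷ _ = ((λ u≡x → x≢u (sym u≡x)) ∷ u∉xs) ∷ ++⁻ˡ xs x∉ ∷ uxs

module _ {n} (G : Graph n) where

  Chain-++-∷⇒Chain : ∀ {u ys} xs → Chain G (xs ++ u ∷ ys) → Chain G (xs ++ u ∷ [])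
  Chain-++-∷⇒Chain []           _           = one
  Chain-++-∷⇒Chain (x ∷ [])     (cons a _)  = cons a one
  Chain-++-∷⇒Chain (x ∷ y ∷ xs) (cons a ch) = cons a (Chain-++-∷⇒Chain (y ∷ xs) ch)

  open import Data.List.Membership.DecPropositional (_≟_ {n}) using () renaming (_∈?_ to _∈ˡ?_)

  OnlyNeighbour : Fin n → Fin n → Set
  OnlyNeighbour l s = ∀ u → Adjacent G l u → u ≡ s

  -- Paths are vertex lists with their newest end first.
  Stuck : Fin n → List (Fin n) → Set
  Stuck w ws = ∀ u → Adjacent G w u → u ∈ˡ w ∷ ws

  module _ (acyclic : Acyclic G) where

    acyclic-path-has-no-chord : ∀ {w p u} rest → Unique (w ∷ p ∷ rest) → Chain G (w ∷ p ∷ rest) →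
      u ∈ˡ rest → ¬ Adjacent G w u
    acyclic-path-has-no-chord {w} {p} rest uniq ch u∈rest wu with ∈-∃++ u∈rest
    ... | pre , post , refl =
      acyclic (_ ∷ w ∷ p ∷ pre)
        ( s≤s (s≤s (s≤s z≤n))
        , Unique-++-∷⇒Unique-∷ (w ∷ p ∷ pre) uniq
        , cons (adjacent-sym G wu) (Chain-++-∷⇒Chain (w ∷ p ∷ pre) ch))

    stuck-end-has-only-neighbour : ∀ w ws → Unique (w ∷ ws) → Chain G (w ∷ ws) → Stuck w ws →
      ∃[ s ] OnlyNeighbour w s
    stuck-end-has-only-neighbour w [] _ _ stuck = w , λ u wu → only-w (stuck u wu)
      where
      only-w : ∀ {u} → u ∈ˡ w ∷ [] → u ≡ w
      only-w (here u≡w) = u≡w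
    stuck-end-has-only-neighbour w (p ∷ rest) uniq ch stuck = p , λ u wu → only-p u wu (stuck u wu)
      where
      only-p : ∀ u → Adjacent G w u → u ∈ˡ w ∷ p ∷ rest → u ≡ p
      only-p u wu (here u≡w)          = ⊥-elim (adjacent⇒≢ G wu (sym u≡w))
      only-p u wu (there (here u≡p))  = u≡p
      only-p u wu (there (there u∈r)) = ⊥-elim (acyclic-path-has-no-chord rest uniq ch u∈r wu)

  -- A path has at most n vertices, so the fuel k never runs out.
  extend-to-stuck-path : ∀ k w ws → Unique (w ∷ ws) → Chain G (w ∷ ws) → n < length (w ∷ ws) + k →
    ∃[ w′ ] ∃[ ws′ ] (Unique (w′ ∷ ws′) × Chain G (w′ ∷ ws′) × Stuck w′ ws′)
  extend-to-stuck-path zero w ws uniq _ n<len =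
    ⊥-elim (<⇒≱ (subst (n <_) (+-identityʳ _) n<len) (Unique⇒length≤ (w ∷ ws) uniq))
  extend-to-stuck-path (suc k) w ws uniq ch n<len
    with any? (λ u → T? (adj G w u) ×-dec ¬? (u ∈ˡ? w ∷ ws))
  ... | yes (u , wu , u∉) =
    extend-to-stuck-path k u (w ∷ ws) (¬Any⇒All¬ (w ∷ ws) u∉ ∷ uniq) (cons (adjacent-sym G wu) ch)
      (subst (n <_) (+-suc (length (w ∷ ws)) k) n<len)
  ... | no  no-new = w , ws , uniq , ch , λ u wu →
    decidable-stable (u ∈ˡ? w ∷ ws) (λ u∉ → no-new (u , wu , u∉))

  acyclic⇒∃OnlyNeighbour : Acyclic G → Fin n → ∃₂ OnlyNeighbour
  acyclic⇒∃OnlyNeighbour acyclic v with extend-to-stuck-path n v [] ([] ∷ []) one (s≤s ≤-refl)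
  ... | w , ws , uniq , ch , stuck = w , stuck-end-has-only-neighbour acyclic w ws uniq ch stuck

  totalDominating⇒∋-and-otherᵇ : ∀ {l s} → OnlyNeighbour l s →
    ∀ D → IsTotalDominating G D → T (∋-and-otherᵇ s D)
  totalDominating⇒∋-and-otherᵇ {l} l-only D tds with tds l
  ... | u , u∈D , lu with l-only u lu
  ... | refl with tds u
  ... | w , w∈D , uw =
    Equivalence.from T-∧
      ( subst T (sym ([]=⇒lookup u∈D)) tt
      , nonemptyᵇ-intro ([]≔-minimal D w u (λ w≡u → adjacent⇒≢ G uw (sym w≡u)) w∈D))

  numTDS≤countTrue-∋-and-otherᵇ : ∀ {l s} → OnlyNeighbour l s →
    numTDS G ≤ countTrue (∋-and-otherᵇ s) (allSubsets n)
  numTDS≤countTrue-∋-and-otherᵇ l-only =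
    countTrue-mono (λ D tds → totalDominating⇒∋-and-otherᵇ l-only D (T-does⇒witness (isTotalDominating? G D) tds))
                   (allSubsets n)

countTrue-∋-and-otherᵇ≤numTDS-star : ∀ m →
  countTrue (∋-and-otherᵇ zero) (allSubsets (suc m)) ≤ numTDS (star (suc m))
countTrue-∋-and-otherᵇ≤numTDS-star m =
  countTrue-mono (λ D other → witness⇒T-does (isTotalDominating? (star (suc m)) D)
                                              (∋-and-otherᵇ⇒star-totalDominating D other))
                 (allSubsets (suc m))

corollary5p1 : (n : ℕ) → n ≥ 1 →
    IsTree (star n) × ((G : Graph n) → IsTree G → numTDS G ≤ numTDS (star n))
corollary5p1 (suc m) _ = (star-connected , star-acyclic) , numTDS≤numTDS-star
  where
  numTDS≤numTDS-star : (G : Graph (suc m)) → IsTree G → numTDS G ≤ numTDS (star (suc m))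
  numTDS≤numTDS-star G (_ , acyclic) with acyclic⇒∃OnlyNeighbour G acyclic zero
  ... | l , s , l-only =
    ≤-trans (numTDS≤countTrue-∋-and-otherᵇ G l-only)
      (≤-trans (≤-reflexive (countTrue-∋-and-otherᵇ-independent m s))
               (countTrue-∋-and-otherᵇ≤numTDS-star m))
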